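{- Let $p$ be a prime, let $G_n$ be a multigraph with vertices $v_1,\dots,v_n$ and adjacency matrix $\Gamma$, let $\Lambda=[I_n\,|\,\Gamma]$ over $\mathbb{Z}/p\mathbb{Z}$, and let $C_r,C_s\in(\mathbb{Z}/p\mathbb{Z})^n$ be two labellings. Then $$\Delta_{rs}(G_n)=\min\left\{\sum_{i=1}^n\chi(k'_i)>0 \;\middle|\; k'\in(\mathbb{Z}/p\mathbb{Z})^{2n},\ \Lambda k'=C_r-C_s \pmod p\right\}.$$
   Context: $G_n$ is an undirected multigraph with vertex set $\{v_1,\dots,v_n\}$; $\Gamma$ is the $n\times n$ matrix with $\Gamma_{ij}$ the number of edges between $v_i$ and $v_j$ (mod $p$), $0$ if none. Labellings are elements $L=(L_1,\dots,L_n)\in(\mathbb{Z}/p\mathbb{Z})^n$. For each $i$, $Z_i:(\mathbb{Z}/p\mathbb{Z})^n\to(\mathbb{Z}/p\mathbb{Z})^n$ replaces $L_i$ by $L_i+1\bmod p$ and leaves other entries unchanged; $X_i$ replaces each $L_j$ by $L_j+\Gamma_{ij}\bmod p$ for all $1\le j\le n$. $\langle Z_i,X_i\rangle$ is the group of maps generated by $Z_i,X_i$ under composition, $I$ is the identity map, and for $O_i\in\langle Z_i,X_i\rangle$, $\eta(O_i)=1$ if $O_i\ne I$, $\eta(O_i)=0$ if $O_i=I$. With $G_n$ originally labelled by $C_r$, the diagonal distance between $C_r$ and $C_s$ is $$\Delta_{rs}(G_n)=\min\left\{\sum_{i=1}^n\eta(O_i)>0 \;\middle|\; \prod_{i=1}^n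 O_i=L_{rs},\ O_i\in\langle Z_i,X_i\rangle,\ 1\le i\le n\right\},$$ where $\prod$ is composition and the condition $\prod O_i=L_{rs}$ means that the composed map sends the labelling $C_r$ to the labelling $C_s$. For $k'=(k'_1,\dots,k'_{2n})$ and $1\le i\le n$, $\chi(k'_i)=1$ if $k'_i\ne0$ or $k'_{i+n}\ne0$, and $\chi(k'_i)=0$ otherwise. $I_n$ is the $n\times n$ identity matrix. -}

module Defs where

open import Data.Nat as ℕ using (ℕ; zero; suc; NonZero; _<_; _≤_)
open import Data.Nat.DivMod using (_mod_)
open import Data.Fin as Fin using (Fin; toℕ; _↑ˡ_; _↑ʳ_; splitAt)
open import Data.Fin.Properties using () renaming (_≟_ to _≟F_)
open import Data.Bool using (Bool; true; false; if_then_else_; _∧_)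
open import Data.Sum using (_⊎_; inj₁; inj₂)
open import Data.Product using (Σ; ∃; _×_; _,_)
open import Relation.Nullary using (¬_; does)
open import Relation.Binary.PropositionalEquality using (_≡_)
open import Function using (_∘_; id)

module _ (p : ℕ) .{{_ : NonZero p}} where

  ZMod : Set
  ZMod = Fin p

  infixl 6 _+ₚ_ _-ₚ_
  infixl 7 _*ₚ_

  _+ₚ_ : ZMod → ZMod → ZMod
  a +ₚ b = (toℕ a ℕ.+ toℕ b) mod p

  _*ₚ_ : ZMod → ZMod → ZMod
  a *ₚ b = (toℕ a ℕ.* toℕ b) mod p

  -ₚ_ : ZMod → ZMod
  -ₚ a = (p ℕ.∸ toℕ a) mod p

  _-ₚ_ : ZMod → ZMod → ZMod
  a -ₚ b = a +ₚ (-ₚ b)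

  0ₚ 1ₚ : ZMod
  0ₚ = 0 mod p
  1ₚ = 1 mod p

  sumₚ : ∀ {m} → (Fin m → ZMod) → ZMod
  sumₚ {zero}  f = 0ₚ
  sumₚ {suc m} f = f Fin.zero +ₚ sumₚ (f ∘ Fin.suc)

  Labelling : ℕ → Set
  Labelling n = Fin n → ZMod

  -- Adjacency matrix Γ of a multigraph given by its edge-multiplicity
  -- function (number of edges between v_i and v_j), reduced mod p.
  adj : ∀ {n} → (Fin n → Fin n → ℕ) → Fin n → Fin n → ZMod
  adj mult i j = mult i j mod p

  module Ops {n : ℕ} (Γ : Fin n → Fin n → ZMod) where

    Zop : Fin n → Labelling n → Labelling n
    Zop i L j = if does (j ≟F i) then L j +ₚ 1ₚ else L j

    Zinv : Fin n → Labelling n → Labelling n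
    Zinv i L j = if does (j ≟F i) then L j -ₚ 1ₚ else L j

    Xop : Fin n → Labelling n → Labelling n
    Xop i L j = L j +ₚ Γ i j

    Xinv : Fin n → Labelling n → Labelling n
    Xinv i L j = L j -ₚ Γ i j

    data Gen (i : Fin n) : (Labelling n → Labelling n) → Set where
      gen-id   : Gen i id
      gen-Z    : ∀ {f} → Gen i f → Gen i (Zop i ∘ f)
      gen-Zinv : ∀ {f} → Gen i f → Gen i (Zinv i ∘ f)
      gen-X    : ∀ {f} → Gen i f → Gen i (Xop i ∘ f)
      gen-Xinv : ∀ {f} → Gen i f → Gen i (Xinv i ∘ f)

    IsIdentity : (Labelling n → Labelling n) → Set
    IsIdentity O = ∀ L j → O L j ≡ L j

    IsEta : (Fin n → Labelling n → Labelling n) → (Fin n → ℕ) → Set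
    IsEta O e = ∀ i → (e i ≡ 1 × ¬ IsIdentity (O i)) ⊎ (e i ≡ 0 × IsIdentity (O i))

    Λ : Fin n → Fin (n ℕ.+ n) → ZMod
    Λ j c with splitAt n c
    ... | inj₁ i = if does (j ≟F i) then 1ₚ else 0ₚ
    ... | inj₂ i = Γ j i

    Λmul : (Fin (n ℕ.+ n) → ZMod) → Labelling n
    Λmul k j = sumₚ (λ c → Λ j c *ₚ k c)

composeAll : ∀ {A : Set} m → (Fin m → A → A) → A → A
composeAll zero    O = id
composeAll (suc m) O = O Fin.zero ∘ composeAll m (O ∘ Fin.suc)

sumℕ : ∀ {m} → (Fin m → ℕ) → ℕ
sumℕ {zero}  f = 0
sumℕ {suc m} f = f Fin.zero ℕ.+ sumℕ (f ∘ Fin.suc)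

isZero : ∀ {p} → Fin p → Bool
isZero Fin.zero = true
isZero (Fin.suc _) = false

χ : ∀ {p n} → (Fin (n ℕ.+ n) → Fin p) → Fin n → ℕ
χ {n = n} k i = if isZero (k (i ↑ˡ n)) ∧ isZero (k (n ↑ʳ i)) then 0 else 1

IsMin : (ℕ → Set) → ℕ → Set
IsMin S m = S m × (∀ k → S k → m ≤ k)

module _ (p : ℕ) .{{_ : NonZero p}} {n : ℕ} (Γ : Fin n → Fin n → ZMod p) where
  open Ops p Γ

  DiagSet : Labelling p n → Labelling p n → ℕ → Set
  DiagSet Cr Cs m =
    Σ (Fin n → Labelling p n → Labelling p n) λ O →
      (∀ i → Gen i (O i)) ×
      (∀ j → composeAll n O Cr j ≡ Cs j) ×
      (Σ (Fin n → ℕ) λ e → IsEta O e × sumℕ e ≡ m) ×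
      0 < m

  DiagonalDistance : Labelling p n → Labelling p n → ℕ → Set
  DiagonalDistance Cr Cs = IsMin (DiagSet Cr Cs)

  SolSet : Labelling p n → Labelling p n → ℕ → Set
  SolSet Cr Cs m =
    Σ (Fin (n ℕ.+ n) → ZMod p) λ k →
      (∀ j → Λmul k j ≡ _-ₚ_ p (Cr j) (Cs j)) ×
      sumℕ (χ {p} {n} k) ≡ m ×
      0 < m

-- Every map in ⟨Z_i, X_i⟩ is the translation of labellings by a·e_i + b·Γ_i
-- (Γ_i the i-th row of Γ) for some a, b ∈ ℤ/pℤ, and every such translation lies
-- in ⟨Z_i, X_i⟩. As Γ is symmetric, a·e_i + b·Γ_i is a times column i plus b times
-- column n + i of Λ, so ∏ O_i sends C_r to C_s exactly when k′ = −(a, b) solves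
-- Λk′ = C_r − C_s. Along this correspondence η(O_i) ≤ χ(k′_i), and conversely
-- χ(k′_i) ≤ η(O_i) once the coefficients of every identity O_i are taken to be 0.
-- So each value of either set is bounded below by a value of the other, and the
-- minima agree; the minimum of the solution set exists because membership is
-- decidable and (C_r − C_s, 0) is a solution.

module Submission where

open import Defs
open import Algebra.Bundles using (Ring; CommutativeRing)
open import Algebra.Structures using (IsCommutativeRing)
open import Algebra.Consequences.Propositional
  using (comm∧idˡ⇒id; comm∧invˡ⇒inv; comm∧distrˡ⇒distr)
import Algebra.Properties.AbelianGroup as AbelianGroupProperties
import Algebra.Properties.Group as GroupProperties
import Algebra.Properties.Loop as LoopProperties
import Algebra.Properties.Ring as RingProperties
import Algebra.Properties.RingWithoutOne as RingWithoutOneProperties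
import Algebra.Properties.CommutativeSemigroup as CommutativeSemigroupProperties
import Algebra.Properties.Semiring.Sum as SemiringSum
open import Data.Bool using (true; false; if_then_else_; _∧_)
open import Data.Empty using (⊥-elim)
open import Data.Fin as Fin using (Fin; zero; suc; toℕ; fromℕ<; _↑ˡ_; _↑ʳ_)
open import Data.Fin.Properties
  using (toℕ-injective; toℕ-fromℕ<; toℕ<n; splitAt-↑ˡ; splitAt-↑ʳ; any?; all?;
         finToFun-funToFin)
  renaming (_≟_ to _≟F_)
open import Data.Nat as ℕ using (ℕ; NonZero; _%_; _≤_; _<_; z≤n; s≤s)
import Data.Nat.Properties as ℕ
open import Data.Nat.DivMod
  using (_mod_; %-distribˡ-+; %-distribˡ-*; m<n⇒m%n≡m; [m+n]%n≡m%n; m%n<n)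
open import Data.Nat.Induction using (<-rec)
open import Data.Nat.Primality using (Prime)
open import Data.Product using (Σ; ∃; ∃₂; ∃-syntax; _×_; _,_)
open import Data.Sum using (_⊎_; inj₁; inj₂)
open import Data.Vec.Functional using (_++_)
open import Data.Vec.Functional.Properties using (lookup-++ˡ; lookup-++ʳ)
open import Function using (_∘_; id; _⇔_; mk⇔; Equivalence)
open import Level using (0ℓ)
open import Relation.Nullary using (¬_; Dec; yes; no; does)
open import Relation.Nullary.Decidable using (_×-dec_; map′)
import Relation.Nullary.Decidable as Dec
open import Relation.Unary using (Decidable)
open import Relation.Binary.PropositionalEquality
  using (_≡_; refl; sym; trans; cong; cong₂; subst; subst₂; isEquivalence; module ≡-Reasoning)

module ZModRing (p : ℕ) .{{_ : NonZero p}} where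

  open import Algebra.Definitions {A = ZMod p} _≡_
  open ≡-Reasoning

  private
    infixl 6 _+_
    infixl 7 _*_
    _+_ = _+ₚ_ p
    _*_ = _*ₚ_ p

  toℕ-mod : ∀ m → toℕ (m mod p) ≡ m % p
  toℕ-mod m = toℕ-fromℕ< (m%n<n m p)

  mod-cong : ∀ {m n} → m % p ≡ n % p → m mod p ≡ n mod p
  mod-cong {m} {n} eq = toℕ-injective (trans (toℕ-mod m) (trans eq (sym (toℕ-mod n))))

  toℕ-mod-inverse : ∀ a → toℕ a mod p ≡ a
  toℕ-mod-inverse a = toℕ-injective (trans (toℕ-mod (toℕ a)) (m<n⇒m%n≡m (toℕ<n a)))

  +-mod-homo : ∀ m n → (m ℕ.+ n) mod p ≡ (m mod p) + (n mod p)
  +-mod-homo m n = mod-cong (trans (%-distribˡ-+ m n p)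
    (sym (cong₂ (λ x y → (x ℕ.+ y) % p) (toℕ-mod m) (toℕ-mod n))))

  *-mod-homo : ∀ m n → (m ℕ.* n) mod p ≡ (m mod p) * (n mod p)
  *-mod-homo m n = mod-cong (trans (%-distribˡ-* m n p)
    (sym (cong₂ (λ x y → (x ℕ.* y) % p) (toℕ-mod m) (toℕ-mod n))))

  mod-suc : ∀ m → ℕ.suc m mod p ≡ (m mod p) + 1ₚ p
  mod-suc m = trans (cong (_mod p) (ℕ.+-comm 1 m)) (+-mod-homo m 1)

  -- Each law is pulled back from ℕ along the surjective homomorphism _mod p.
  +ₚ-comm : Commutative _+_
  +ₚ-comm a b = cong (_mod p) (ℕ.+-comm (toℕ a) (toℕ b))

  *ₚ-comm : Commutative _*_
  *ₚ-comm a b = cong (_mod p) (ℕ.*-comm (toℕ a) (toℕ b))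

  +ₚ-assoc : Associative _+_
  +ₚ-assoc a b c = begin
    (a + b) + c                                    ≡⟨ cong ((a + b) +_) (toℕ-mod-inverse c) ⟨
    ((toℕ a ℕ.+ toℕ b) mod p) + (toℕ c mod p)      ≡⟨ +-mod-homo _ _ ⟨
    (toℕ a ℕ.+ toℕ b ℕ.+ toℕ c) mod p              ≡⟨ cong (_mod p) (ℕ.+-assoc (toℕ a) _ _) ⟩
    (toℕ a ℕ.+ (toℕ b ℕ.+ toℕ c)) mod p            ≡⟨ +-mod-homo _ _ ⟩
    (toℕ a mod p) + (b + c)                        ≡⟨ cong (_+ (b + c)) (toℕ-mod-inverse a) ⟩
    a + (b + c)                                    ∎

  *ₚ-assoc : Associative _*_
  *ₚ-assoc a b c = begin
    (a * b) * c                                    ≡⟨ cong ((a * b) *_) (toℕ-mod-inverse c) ⟨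
    ((toℕ a ℕ.* toℕ b) mod p) * (toℕ c mod p)      ≡⟨ *-mod-homo _ _ ⟨
    (toℕ a ℕ.* toℕ b ℕ.* toℕ c) mod p              ≡⟨ cong (_mod p) (ℕ.*-assoc (toℕ a) _ _) ⟩
    (toℕ a ℕ.* (toℕ b ℕ.* toℕ c)) mod p            ≡⟨ *-mod-homo _ _ ⟩
    (toℕ a mod p) * (b * c)                        ≡⟨ cong (_* (b * c)) (toℕ-mod-inverse a) ⟩
    a * (b * c)                                    ∎

  +ₚ-identityˡ : LeftIdentity (0ₚ p) _+_
  +ₚ-identityˡ a = begin
    0ₚ p + a                   ≡⟨ cong (0ₚ p +_) (toℕ-mod-inverse a) ⟨
    (0 mod p) + (toℕ a mod p)  ≡⟨ +-mod-homo 0 (toℕ a) ⟨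
    toℕ a mod p                ≡⟨ toℕ-mod-inverse a ⟩
    a                          ∎

  *ₚ-identityˡ : LeftIdentity (1ₚ p) _*_
  *ₚ-identityˡ a = begin
    1ₚ p * a                   ≡⟨ cong (1ₚ p *_) (toℕ-mod-inverse a) ⟨
    (1 mod p) * (toℕ a mod p)  ≡⟨ *-mod-homo 1 (toℕ a) ⟨
    (1 ℕ.* toℕ a) mod p        ≡⟨ cong (_mod p) (ℕ.*-identityˡ (toℕ a)) ⟩
    toℕ a mod p                ≡⟨ toℕ-mod-inverse a ⟩
    a                          ∎

  -ₚ‿inverseˡ : LeftInverse (0ₚ p) (-ₚ_ p) _+_
  -ₚ‿inverseˡ a = begin
    -ₚ_ p a + a                              ≡⟨ cong (-ₚ_ p a +_) (toℕ-mod-inverse a) ⟨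
    ((p ℕ.∸ toℕ a) mod p) + (toℕ a mod p)    ≡⟨ +-mod-homo _ _ ⟨
    (p ℕ.∸ toℕ a ℕ.+ toℕ a) mod p            ≡⟨ cong (_mod p) (ℕ.m∸n+n≡m (ℕ.<⇒≤ (toℕ<n a))) ⟩
    p mod p                                  ≡⟨ mod-cong ([m+n]%n≡m%n 0 p) ⟩
    0ₚ p                                     ∎

  *ₚ-distribˡ-+ₚ : _*_ DistributesOverˡ _+_
  *ₚ-distribˡ-+ₚ a b c = begin
    a * (b + c)                                      ≡⟨ cong (_* (b + c)) (toℕ-mod-inverse a) ⟨
    (toℕ a mod p) * ((toℕ b ℕ.+ toℕ c) mod p)        ≡⟨ *-mod-homo _ _ ⟨
    (toℕ a ℕ.* (toℕ b ℕ.+ toℕ c)) mod p              ≡⟨ cong (_mod p) (ℕ.*-distribˡ-+ (toℕ a) (toℕ b) _) ⟩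
    (toℕ a ℕ.* toℕ b ℕ.+ toℕ a ℕ.* toℕ c) mod p      ≡⟨ +-mod-homo _ _ ⟩
    a * b + a * c                                    ∎

  isCommutativeRing : IsCommutativeRing _≡_ _+_ _*_ (-ₚ_ p) (0ₚ p) (1ₚ p)
  isCommutativeRing = record
    { isRing = record
      { +-isAbelianGroup = record
        { isGroup = record
          { isMonoid = record
            { isSemigroup = record
              { isMagma = record { isEquivalence = isEquivalence ; ∙-cong = cong₂ _+_ }
              ; assoc = +ₚ-assoc }
            ; identity = comm∧idˡ⇒id +ₚ-comm +ₚ-identityˡ }
          ; inverse = comm∧invˡ⇒inv +ₚ-comm -ₚ‿inverseˡ
          ; ⁻¹-cong = cong (-ₚ_ p) }
        ; comm = +ₚ-comm }
      ; *-cong = cong₂ _*_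
      ; *-assoc = *ₚ-assoc
      ; *-identity = comm∧idˡ⇒id *ₚ-comm *ₚ-identityˡ
      ; distrib = comm∧distrˡ⇒distr (cong₂ _+_) *ₚ-comm *ₚ-distribˡ-+ₚ }
    ; *-comm = *ₚ-comm }

  commutativeRing : CommutativeRing 0ℓ 0ℓ
  commutativeRing = record { isCommutativeRing = isCommutativeRing }

module RingLemmas {c ℓ} (R : Ring c ℓ) where

  open Ring R hiding (zero) renaming (sym to ≈-sym; trans to ≈-trans)
  open AbelianGroupProperties +-abelianGroup using (⁻¹-anti-homo‿-; xyx⁻¹≈y)
  open RingProperties R using (-1*x≈-x)
  open SemiringSum semiring using (sum; sum-cong-≋; sum-replicate-zero; *-distribˡ-sum)
  open import Relation.Binary.Reasoning.Setoid setoid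

  x-[x-y]≈y : ∀ x y → x - (x - y) ≈ y
  x-[x-y]≈y x y = begin
    x - (x - y)    ≈⟨ +-congˡ (⁻¹-anti-homo‿- x y) ⟩
    x + (y - x)    ≈⟨ +-assoc x y (- x) ⟨
    x + y - x      ≈⟨ xyx⁻¹≈y x y ⟩
    y              ∎

  x-u≈y⇔u≈x-y : ∀ x u y → x - u ≈ y ⇔ u ≈ x - y
  x-u≈y⇔u≈x-y x u y = mk⇔
    (λ x-u≈y → ≈-trans (≈-sym (x-[x-y]≈y x u)) (+-congˡ (-‿cong x-u≈y)))
    (λ u≈x-y → ≈-trans (+-congˡ (-‿cong u≈x-y)) (x-[x-y]≈y x y))

  sum-↑ : ∀ m {k} (f : Fin (m ℕ.+ k) → Carrier) →
          sum f ≈ sum (f ∘ (_↑ˡ k)) + sum (f ∘ (m ↑ʳ_))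
  sum-↑ ℕ.zero    f = ≈-sym (+-identityˡ _)
  sum-↑ (ℕ.suc m) f = ≈-trans (+-congˡ (sum-↑ m (f ∘ suc))) (≈-sym (+-assoc _ _ _))

  ∑-neg : ∀ {m} (f : Fin m → Carrier) → sum (λ i → - f i) ≈ - sum f
  ∑-neg f = begin
    sum (λ i → - f i)         ≈⟨ sum-cong-≋ (λ i → ≈-sym (-1*x≈-x (f i))) ⟩
    sum (λ i → - 1# * f i)    ≈⟨ *-distribˡ-sum (- 1#) f ⟨
    - 1# * sum f              ≈⟨ -1*x≈-x (sum f) ⟩
    - sum f                   ∎

  δ : ∀ {m} → Fin m → Fin m → Carrier
  δ i j = if does (j ≟F i) then 1# else 0#

  ∑-δ : ∀ {m} (a : Fin m → Carrier) j → sum (λ i → a i * δ i j) ≈ a j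
  ∑-δ {ℕ.suc m} a zero = begin
    a zero * 1# + sum {m} (λ i → a (suc i) * 0#)  ≈⟨ +-cong (*-identityʳ _) (sum-cong-≋ (zeroʳ ∘ a ∘ suc)) ⟩
    a zero + sum {m} (λ _ → 0#)                   ≈⟨ +-congˡ (sum-replicate-zero m) ⟩
    a zero + 0#                                   ≈⟨ +-identityʳ _ ⟩
    a zero                                        ∎
  ∑-δ {ℕ.suc m} a (suc j) = begin
    a zero * 0# + sum {m} (λ i → a (suc i) * δ i j)  ≈⟨ +-congʳ (zeroʳ (a zero)) ⟩
    0# + sum (λ i → a (suc i) * δ i j)               ≈⟨ +-identityˡ _ ⟩
    sum (λ i → a (suc i) * δ i j)                    ≈⟨ ∑-δ (a ∘ suc) j ⟩
    a (suc j)                                        ∎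

Undercuts : (ℕ → Set) → (ℕ → Set) → Set
Undercuts T S = ∀ {m} → S m → ∃[ m′ ] m′ ≤ m × T m′

IsMin-transport : ∀ {S T Δ} → Undercuts T S → Undercuts S T → IsMin T Δ → IsMin S Δ
IsMin-transport {S} {Δ = Δ} T≤S S≤T (TΔ , minT) with S≤T TΔ
... | m , m≤Δ , Sm = subst S (ℕ.≤-antisym m≤Δ (Δ≤ Sm)) Sm , λ _ → Δ≤
  where
  Δ≤ : ∀ {k} → S k → Δ ≤ k
  Δ≤ Sk = let (k′ , k′≤k , Tk′) = T≤S Sk in ℕ.≤-trans (minT k′ Tk′) k′≤k

IsMin-of-decidable : ∀ {Q : ℕ → Set} → Decidable Q → ∀ {m} → Q m → ∃ (IsMin Q)
IsMin-of-decidable {Q} Q? {m} = <-rec (λ m → Q m → ∃ (IsMin Q)) search m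
  where
  search : ∀ m → (∀ {k} → k < m → Q k → ∃ (IsMin Q)) → Q m → ∃ (IsMin Q)
  search m rec Qm with any? (λ (i : Fin m) → Q? (toℕ i))
  ... | yes (i , Qi) = rec (toℕ<n i) Qi
  ... | no ¬smaller = m , Qm , λ k Qk → ℕ.≮⇒≥ λ k<m →
    ¬smaller (fromℕ< k<m , subst Q (sym (toℕ-fromℕ< k<m)) Qk)

sumℕ-cong : ∀ {m} {f g : Fin m → ℕ} → (∀ i → f i ≡ g i) → sumℕ f ≡ sumℕ g
sumℕ-cong {ℕ.zero}  eq = refl
sumℕ-cong {ℕ.suc m} eq = cong₂ ℕ._+_ (eq zero) (sumℕ-cong (eq ∘ suc))

sumℕ-mono-≤ : ∀ {m} {f g : Fin m → ℕ} → (∀ i → f i ≤ g i) → sumℕ f ≤ sumℕ g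
sumℕ-mono-≤ {ℕ.zero}  le = z≤n
sumℕ-mono-≤ {ℕ.suc m} le = ℕ.+-mono-≤ (le zero) (sumℕ-mono-≤ (le ∘ suc))

sumℕ≡0⇒≡0 : ∀ {m} (f : Fin m → ℕ) → sumℕ f ≡ 0 → ∀ i → f i ≡ 0
sumℕ≡0⇒≡0 f eq zero    = ℕ.m+n≡0⇒m≡0 (f zero) eq
sumℕ≡0⇒≡0 f eq (suc i) = sumℕ≡0⇒≡0 (f ∘ suc) (ℕ.m+n≡0⇒n≡0 (f zero) eq) i

∃-fun? : ∀ {m k} {P : (Fin m → Fin k) → Set} →
         (∀ {f g} → (∀ i → f i ≡ g i) → P f → P g) → Decidable P → Dec (∃ P)
∃-fun? resp P? = map′
  (λ (x , Px) → Fin.finToFun x , Px)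
  (λ (f , Pf) → Fin.funToFin f , resp (λ i → sym (finToFun-funToFin f i)) Pf)
  (any? (P? ∘ Fin.finToFun))

weight : ∀ {p} → Fin p → Fin p → ℕ
weight α β = if isZero α ∧ isZero β then 0 else 1

weight≤1 : ∀ {p} (α β : Fin p) → weight α β ≤ 1
weight≤1 α β with isZero α ∧ isZero β
... | true  = z≤n
... | false = s≤s z≤n

weight-0 : ∀ p .{{_ : NonZero p}} → weight (0ₚ p) (0ₚ p) ≡ 0
weight-0 (ℕ.suc _) = refl

weight≡0⇒≡0 : ∀ p .{{_ : NonZero p}} (α β : Fin p) → weight α β ≡ 0 → α ≡ 0ₚ p × β ≡ 0ₚ p
weight≡0⇒≡0 (ℕ.suc _) zero    zero    _  = refl , refl
weight≡0⇒≡0 (ℕ.suc _) zero    (suc _) ()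
weight≡0⇒≡0 (ℕ.suc _) (suc _) _       ()

η : ∀ {A : Set} → Dec A → ℕ
η (yes _) = 0
η (no _)  = 1

η≤ : ∀ {A : Set} (d : Dec A) w → (w ≡ 0 → A) → η d ≤ w
η≤ (yes _) w         _      = z≤n
η≤ (no ¬a) ℕ.zero    w≡0⇒a = ⊥-elim (¬a (w≡0⇒a refl))
η≤ (no _)  (ℕ.suc _) _      = s≤s z≤n

module Translations (p : ℕ) .{{_ : NonZero p}} {n : ℕ} (Γ : Fin n → Fin n → ZMod p) where

  open Ops p Γ
  open ZModRing p using (commutativeRing; toℕ-mod-inverse; mod-suc)
  open CommutativeRing commutativeRing
    using (_+_; _*_; -_; _-_; 0#; 1#; +-assoc; +-comm; +-identityʳ;
           *-comm; *-identityˡ; *-identityʳ; zeroˡ; zeroʳ; distribʳ;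
           ring; semiring; +-abelianGroup; +-group; +-commutativeSemigroup)
  open AbelianGroupProperties +-abelianGroup using (⁻¹-∙-comm)
  open GroupProperties +-group using (loop; x∙y⁻¹≈ε⇒x≈y; ε⁻¹≈ε; ⁻¹-involutive)
  open LoopProperties loop using (identityʳ-unique)
  open RingProperties ring using (-1*x≈-x)
  open RingWithoutOneProperties (Ring.ringWithoutOne ring)
    using (-‿distribˡ-*)
  open CommutativeSemigroupProperties +-commutativeSemigroup using (xy∙z≈xz∙y)
  open SemiringSum semiring using (sum; sum-cong-≗; ∑-distrib-+; sum-replicate-zero)
  open RingLemmas ring using (x-u≈y⇔u≈x-y; sum-↑; ∑-neg; δ; ∑-δ)
  open ≡-Reasoning

  Map : Set
  Map = Labelling p n → Labelling p n

  sumₚ≡sum : ∀ {m} (f : Fin m → ZMod p) → sumₚ p f ≡ sum f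
  sumₚ≡sum {ℕ.zero}  f = refl
  sumₚ≡sum {ℕ.suc m} f = cong (f zero +_) (sumₚ≡sum (f ∘ suc))

  -- α times column i of Λ plus β times column n + i; the latter is row i of Γ when Γ is symmetric.
  Λ-pair : Fin n → ZMod p → ZMod p → Labelling p n
  Λ-pair i α β j = α * δ i j + β * Γ i j

  Λ-pair-0 : ∀ i j → Λ-pair i 0# 0# j ≡ 0#
  Λ-pair-0 i j = trans (cong₂ _+_ (zeroˡ (δ i j)) (zeroˡ (Γ i j))) (+-identityʳ 0#)

  Λ-pair-neg-0 : ∀ i j → Λ-pair i (- 0#) (- 0#) j ≡ 0#
  Λ-pair-neg-0 i j = trans (cong₂ (λ α β → Λ-pair i α β j) ε⁻¹≈ε ε⁻¹≈ε) (Λ-pair-0 i j)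

  Λ-pair-neg : ∀ i α β j → Λ-pair i (- α) (- β) j ≡ - Λ-pair i α β j
  Λ-pair-neg i α β j =
    trans (cong₂ _+_ (sym (-‿distribˡ-* α (δ i j))) (sym (-‿distribˡ-* β (Γ i j))))
          (⁻¹-∙-comm (α * δ i j) (β * Γ i j))

  Λ-↑ˡ : ∀ j i → Λ j (i ↑ˡ n) ≡ δ i j
  Λ-↑ˡ j i rewrite splitAt-↑ˡ n i n = refl

  Λ-↑ʳ : ∀ j i → Λ j (n ↑ʳ i) ≡ Γ j i
  Λ-↑ʳ j i rewrite splitAt-↑ʳ n n i = refl

  Λmul-pairs : (∀ i j → Γ i j ≡ Γ j i) → ∀ k j →
               Λmul k j ≡ sum (λ i → Λ-pair i (k (i ↑ˡ n)) (k (n ↑ʳ i)) j)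
  Λmul-pairs Γ-sym k j = begin
    Λmul k j                                              ≡⟨ sumₚ≡sum (λ c → Λ j c * k c) ⟩
    sum (λ c → Λ j c * k c)                               ≡⟨ sum-↑ n (λ c → Λ j c * k c) ⟩
    sum (λ i → Λ j (i ↑ˡ n) * k (i ↑ˡ n)) +
      sum (λ i → Λ j (n ↑ʳ i) * k (n ↑ʳ i))               ≡⟨ cong₂ _+_ (sum-cong-≗ identity-part) (sum-cong-≗ Γ-part) ⟩
    sum (λ i → k (i ↑ˡ n) * δ i j) +
      sum (λ i → k (n ↑ʳ i) * Γ i j)                      ≡⟨ ∑-distrib-+ (λ i → k (i ↑ˡ n) * δ i j) (λ i → k (n ↑ʳ i) * Γ i j) ⟨
    sum (λ i → Λ-pair i (k (i ↑ˡ n)) (k (n ↑ʳ i)) j)      ∎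
    where
    identity-part : ∀ i → Λ j (i ↑ˡ n) * k (i ↑ˡ n) ≡ k (i ↑ˡ n) * δ i j
    identity-part i = trans (cong (_* k (i ↑ˡ n)) (Λ-↑ˡ j i)) (*-comm (δ i j) (k (i ↑ˡ n)))
    Γ-part : ∀ i → Λ j (n ↑ʳ i) * k (n ↑ʳ i) ≡ k (n ↑ʳ i) * Γ i j
    Γ-part i = trans (cong (_* k (n ↑ʳ i)) (trans (Λ-↑ʳ j i) (Γ-sym j i))) (*-comm (Γ i j) (k (n ↑ʳ i)))

  Λmul-cong : ∀ {k k′} → (∀ c → k c ≡ k′ c) → ∀ j → Λmul k j ≡ Λmul k′ j
  Λmul-cong {k} {k′} k≗k′ j = begin
    Λmul k j                  ≡⟨ sumₚ≡sum (λ c → Λ j c * k c) ⟩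
    sum (λ c → Λ j c * k c)   ≡⟨ sum-cong-≗ (λ c → cong (Λ j c *_) (k≗k′ c)) ⟩
    sum (λ c → Λ j c * k′ c)  ≡⟨ sumₚ≡sum (λ c → Λ j c * k′ c) ⟨
    Λmul k′ j                 ∎

  Translates : Map → Labelling p n → Set
  Translates O t = ∀ L j → O L j ≡ L j + t j

  Translates-cong : ∀ {O t t′} → (∀ j → t j ≡ t′ j) → Translates O t → Translates O t′
  Translates-cong t≡t′ tr L j = trans (tr L j) (cong (L j +_) (t≡t′ j))

  ∘-translates : ∀ {O O′ t t′} → Translates O t → Translates O′ t′ →
                 Translates (O′ ∘ O) (λ j → t j + t′ j)
  ∘-translates {O} {t = t} {t′} tr tr′ L j =
    trans (tr′ (O L) j) (trans (cong (_+ t′ j) (tr L j)) (+-assoc (L j) (t j) (t′ j)))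

  identity-translates : ∀ {O t} → IsIdentity O → (∀ j → t j ≡ 0#) → Translates O t
  identity-translates O≡id t≡0 L j =
    trans (O≡id L j) (sym (trans (cong (L j +_) (t≡0 j)) (+-identityʳ (L j))))

  translation-zero⇔identity : ∀ {O t} → Translates O t → (∀ j → t j ≡ 0#) ⇔ IsIdentity O
  translation-zero⇔identity {t = t} tr = mk⇔
    (λ t≡0 L j → trans (tr L j) (trans (cong (L j +_) (t≡0 j)) (+-identityʳ (L j))))
    (λ O≡id j → identityʳ-unique 0# (t j) (trans (sym (tr (λ _ → 0#) j)) (O≡id (λ _ → 0#) j)))

  identity? : ∀ {O t} → Translates O t → Dec (IsIdentity O)
  identity? {t = t} tr = Dec.map (translation-zero⇔identity tr) (all? (λ j → t j ≟F 0#))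

  composeAll-translates : ∀ {m} {O : Fin m → Map} {t : Fin m → Labelling p n} →
    (∀ i → Translates (O i) (t i)) → Translates (composeAll m O) (λ j → sum (λ i → t i j))
  composeAll-translates {ℕ.zero}  _  L j = sym (+-identityʳ (L j))
  composeAll-translates {ℕ.suc m} {t = t} tr =
    Translates-cong (λ j → +-comm (sum (λ i → t (suc i) j)) (t zero j))
                    (∘-translates (composeAll-translates (tr ∘ suc)) (tr zero))

  composeAll-identity : ∀ {m} {O : Fin m → Map} → (∀ i → IsIdentity (O i)) → IsIdentity (composeAll m O)
  composeAll-identity {ℕ.zero}      _    L j = refl
  composeAll-identity {ℕ.suc m} {O} O≡id L j =
    trans (O≡id zero _ j) (composeAll-identity (O≡id ∘ suc) L j)

  Zop-translates : ∀ i → Translates (Zop i) (λ j → 1# * δ i j)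
  Zop-translates i L j with does (j ≟F i)
  ... | true  = cong (L j +_) (sym (*-identityˡ 1#))
  ... | false = sym (trans (cong (L j +_) (zeroʳ 1#)) (+-identityʳ (L j)))

  Zinv-translates : ∀ i → Translates (Zinv i) (λ j → - 1# * δ i j)
  Zinv-translates i L j with does (j ≟F i)
  ... | true  = cong (L j +_) (sym (*-identityʳ (- 1#)))
  ... | false = sym (trans (cong (L j +_) (zeroʳ (- 1#))) (+-identityʳ (L j)))

  Xop-translates : ∀ i → Translates (Xop i) (λ j → 1# * Γ i j)
  Xop-translates i L j = cong (L j +_) (sym (*-identityˡ (Γ i j)))

  Xinv-translates : ∀ i → Translates (Xinv i) (λ j → - 1# * Γ i j)
  Xinv-translates i L j = cong (L j +_) (sym (-1*x≈-x (Γ i j)))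

  Λ-pair-stepᶻ : ∀ {i O O′ a b c} → Translates O′ (λ j → c * δ i j) →
                 Translates O (Λ-pair i a b) → Translates (O′ ∘ O) (Λ-pair i (a + c) b)
  Λ-pair-stepᶻ {i} {a = a} {b} {c} tr′ tr = Translates-cong shift (∘-translates tr tr′)
    where
    shift : ∀ j → Λ-pair i a b j + c * δ i j ≡ Λ-pair i (a + c) b j
    shift j = trans (xy∙z≈xz∙y (a * δ i j) (b * Γ i j) (c * δ i j))
                    (cong (_+ b * Γ i j) (sym (distribʳ (δ i j) a c)))

  Λ-pair-stepˣ : ∀ {i O O′ a b c} → Translates O′ (λ j → c * Γ i j) →
                 Translates O (Λ-pair i a b) → Translates (O′ ∘ O) (Λ-pair i a (b + c))
  Λ-pair-stepˣ {i} {a = a} {b} {c} tr′ tr = Translates-cong shift (∘-translates tr tr′)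
    where
    shift : ∀ j → Λ-pair i a b j + c * Γ i j ≡ Λ-pair i a (b + c) j
    shift j = trans (+-assoc (a * δ i j) (b * Γ i j) (c * Γ i j))
                    (cong (a * δ i j +_) (sym (distribʳ (Γ i j) b c)))

  Gen-translates : ∀ {i O} → Gen i O → ∃₂ λ a b → Translates O (Λ-pair i a b)
  Gen-translates {i} gen-id = 0# , 0# , identity-translates (λ _ _ → refl) (Λ-pair-0 i)
  Gen-translates (gen-Z g)    with Gen-translates g
  ... | a , b , tr = a + 1# , b , Λ-pair-stepᶻ {a = a} {b} {1#} (Zop-translates _) tr
  Gen-translates (gen-Zinv g) with Gen-translates g
  ... | a , b , tr = a - 1# , b , Λ-pair-stepᶻ {a = a} {b} { - 1#} (Zinv-translates _) tr
  Gen-translates (gen-X g)    with Gen-translates g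
  ... | a , b , tr = a , b + 1# , Λ-pair-stepˣ {a = a} {b} {1#} (Xop-translates _) tr
  Gen-translates (gen-Xinv g) with Gen-translates g
  ... | a , b , tr = a , b - 1# , Λ-pair-stepˣ {a = a} {b} { - 1#} (Xinv-translates _) tr

  realise : ∀ i (a b : ℕ) → ∃ λ O → Gen i O × Translates O (Λ-pair i (a mod p) (b mod p))
  realise i ℕ.zero ℕ.zero = id , gen-id , identity-translates (λ _ _ → refl) (Λ-pair-0 i)
  realise i ℕ.zero (ℕ.suc b) with realise i 0 b
  ... | O , g , tr = Xop i ∘ O , gen-X g ,
    subst (λ β → Translates (Xop i ∘ O) (Λ-pair i 0# β)) (sym (mod-suc b))
          (Λ-pair-stepˣ {a = 0#} {b mod p} {1#} (Xop-translates i) tr)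
  realise i (ℕ.suc a) b with realise i a b
  ... | O , g , tr = Zop i ∘ O , gen-Z g ,
    subst (λ α → Translates (Zop i ∘ O) (Λ-pair i α (b mod p))) (sym (mod-suc a))
          (Λ-pair-stepᶻ {a = a mod p} {b mod p} {1#} (Zop-translates i) tr)

  Gen-realises : ∀ i a b → ∃ λ O → Gen i O × Translates O (Λ-pair i a b)
  Gen-realises i a b = subst₂ (λ α β → ∃ λ O → Gen i O × Translates O (Λ-pair i α β))
    (toℕ-mod-inverse a) (toℕ-mod-inverse b) (realise i (toℕ a) (toℕ b))

  EtaValue : Map → ℕ → Set
  EtaValue O e = (e ≡ 1 × ¬ IsIdentity O) ⊎ (e ≡ 0 × IsIdentity O)

  η-spec : ∀ {O} (d : Dec (IsIdentity O)) → EtaValue O (η d)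
  η-spec (yes O≡id) = inj₂ (refl , O≡id)
  η-spec (no O≢id)  = inj₁ (refl , O≢id)

  EtaValue-0 : ∀ {O e} → EtaValue O e → e ≡ 0 → IsIdentity O
  EtaValue-0 (inj₁ (refl , _))    ()
  EtaValue-0 (inj₂ (_ , O≡id)) _ = O≡id

  record Realisation (i : Fin n) (α β : ZMod p) : Set where
    field
      op          : Map
      eta         : ℕ
      generated   : Gen i op
      translation : Translates op (Λ-pair i (- α) (- β))
      eta-value   : EtaValue op eta
      eta≤weight  : eta ≤ weight α β

  realisation : ∀ i α β → Realisation i α β
  realisation i α β with Gen-realises i (- α) (- β)
  ... | O , g , tr = record
    { op = O ; eta = η (identity? tr) ; generated = g ; translation = tr
    ; eta-value = η-spec (identity? tr)
    ; eta≤weight = η≤ (identity? tr) (weight α β) weight≡0⇒identity }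
    where
    weight≡0⇒identity : weight α β ≡ 0 → IsIdentity O
    weight≡0⇒identity w≡0 with weight≡0⇒≡0 p α β w≡0
    ... | refl , refl = Equivalence.to (translation-zero⇔identity tr) (Λ-pair-neg-0 i)

  record Coefficients (i : Fin n) (O : Map) (e : ℕ) : Set where
    field
      α β         : ZMod p
      translation : Translates O (Λ-pair i (- α) (- β))
      weight≤eta  : weight α β ≤ e

  coefficients : ∀ {i O e} → Gen i O → EtaValue O e → Coefficients i O e
  coefficients {i} g (inj₁ (refl , _)) with Gen-translates g
  ... | a , b , tr = record
    { α = - a ; β = - b ; translation = Translates-cong involution tr
    ; weight≤eta = weight≤1 (- a) (- b) }
    where
    involution : ∀ j → Λ-pair i a b j ≡ Λ-pair i (- - a) (- - b) j
    involution j = sym (cong₂ (λ α β → Λ-pair i α β j) (⁻¹-involutive a) (⁻¹-involutive b))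
  -- Gen-translates may give an identity O nonzero coefficients, which would break weight ≤ 0.
  coefficients {i} g (inj₂ (refl , O≡id)) = record
    { α = 0# ; β = 0# ; translation = identity-translates O≡id (Λ-pair-neg-0 i)
    ; weight≤eta = ℕ.≤-reflexive (weight-0 p) }

  module Correspondence (Γ-sym : ∀ i j → Γ i j ≡ Γ j i) (Cr Cs : Labelling p n)
                        (Cr≢Cs : ¬ (∀ j → Cr j ≡ Cs j)) where

    Λmul-++ : ∀ (α β : Fin n → ZMod p) j → Λmul (α ++ β) j ≡ sum (λ i → Λ-pair i (α i) (β i) j)
    Λmul-++ α β j = trans (Λmul-pairs Γ-sym (α ++ β) j) (sum-cong-≗ λ i →
      cong₂ (λ a b → Λ-pair i a b j) (lookup-++ˡ α β i) (lookup-++ʳ α β i))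

    χ-++ : ∀ (α β : Fin n → ZMod p) i → χ {p} {n} (α ++ β) i ≡ weight (α i) (β i)
    χ-++ α β i = cong₂ weight (lookup-++ˡ α β i) (lookup-++ʳ α β i)

    composeAll-translates-Λmul : ∀ {O} k →
      (∀ i → Translates (O i) (Λ-pair i (- k (i ↑ˡ n)) (- k (n ↑ʳ i)))) →
      Translates (composeAll n O) (λ j → - Λmul k j)
    composeAll-translates-Λmul k tr = Translates-cong total (composeAll-translates tr)
      where
      total : ∀ j → sum (λ i → Λ-pair i (- k (i ↑ˡ n)) (- k (n ↑ʳ i)) j) ≡ - Λmul k j
      total j = begin
        sum (λ i → Λ-pair i (- k (i ↑ˡ n)) (- k (n ↑ʳ i)) j)  ≡⟨ sum-cong-≗ (λ i → Λ-pair-neg i (k (i ↑ˡ n)) (k (n ↑ʳ i)) j) ⟩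
        sum (λ i → - Λ-pair i (k (i ↑ˡ n)) (k (n ↑ʳ i)) j)    ≡⟨ ∑-neg (λ i → Λ-pair i (k (i ↑ˡ n)) (k (n ↑ʳ i)) j) ⟩
        - sum (λ i → Λ-pair i (k (i ↑ˡ n)) (k (n ↑ʳ i)) j)    ≡⟨ cong -_ (Λmul-pairs Γ-sym k j) ⟨
        - Λmul k j                                             ∎

    Sol-positive : ∀ {k} → (∀ j → Λmul k j ≡ Cr j - Cs j) → 0 < sumℕ (χ {p} {n} k)
    Sol-positive {k} solves = ℕ.n≢0⇒n>0 λ sum≡0 → Cr≢Cs λ j →
      x∙y⁻¹≈ε⇒x≈y (Cr j) (Cs j) (trans (sym (solves j)) (Λmul-vanishes sum≡0 j))
      where
      Λmul-vanishes : sumℕ (χ {p} {n} k) ≡ 0 → ∀ j → Λmul k j ≡ 0#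
      Λmul-vanishes sum≡0 j = begin
        Λmul k j                                            ≡⟨ Λmul-pairs Γ-sym k j ⟩
        sum (λ i → Λ-pair i (k (i ↑ˡ n)) (k (n ↑ʳ i)) j)   ≡⟨ sum-cong-≗ pair-vanishes ⟩
        sum {n} (λ _ → 0#)                                  ≡⟨ sum-replicate-zero n ⟩
        0#                                                  ∎
        where
        pair-vanishes : ∀ i → Λ-pair i (k (i ↑ˡ n)) (k (n ↑ʳ i)) j ≡ 0#
        pair-vanishes i with weight≡0⇒≡0 p (k (i ↑ˡ n)) (k (n ↑ʳ i)) (sumℕ≡0⇒≡0 (χ {p} {n} k) sum≡0 i)
        ... | α≡0 , β≡0 = trans (cong₂ (λ α β → Λ-pair i α β j) α≡0 β≡0) (Λ-pair-0 i j)

    Diag-positive : ∀ {O e} → (∀ j → composeAll n O Cr j ≡ Cs j) → IsEta O e → 0 < sumℕ e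
    Diag-positive {e = e} reaches etas = ℕ.n≢0⇒n>0 λ sum≡0 → Cr≢Cs λ j →
      trans (sym (composeAll-identity (λ i → EtaValue-0 (etas i) (sumℕ≡0⇒≡0 e sum≡0 i)) Cr j))
            (reaches j)

    Sol⇒Diag : Undercuts (DiagSet p Γ Cr Cs) (SolSet p Γ Cr Cs)
    Sol⇒Diag (k , solves , refl , _) =
      sumℕ e , sumℕ-mono-≤ (eta≤weight ∘ R) , O , generated ∘ R , reaches ,
      (e , eta-value ∘ R , refl) , Diag-positive reaches (eta-value ∘ R)
      where
      open Realisation
      R : ∀ i → Realisation i (k (i ↑ˡ n)) (k (n ↑ʳ i))
      R i = realisation i (k (i ↑ˡ n)) (k (n ↑ʳ i))
      O : Fin n → Map
      O = op ∘ R
      e : Fin n → ℕ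
      e = eta ∘ R
      reaches : ∀ j → composeAll n O Cr j ≡ Cs j
      reaches j = trans (composeAll-translates-Λmul k (translation ∘ R) Cr j)
                        (Equivalence.from (x-u≈y⇔u≈x-y (Cr j) (Λmul k j) (Cs j)) (solves j))

    Diag⇒Sol : Undercuts (SolSet p Γ Cr Cs) (DiagSet p Γ Cr Cs)
    Diag⇒Sol (O , gens , reaches , (e , etas , refl) , _) =
      sumℕ (χ {p} {n} k) , sumℕ-mono-≤ χ≤e , k , solves , refl , Sol-positive solves
      where
      open Coefficients
      C : ∀ i → Coefficients i (O i) (e i)
      C i = coefficients (gens i) (etas i)
      k : Fin (n ℕ.+ n) → ZMod p
      k = (α ∘ C) ++ (β ∘ C)
      translations : ∀ i → Translates (O i) (Λ-pair i (- k (i ↑ˡ n)) (- k (n ↑ʳ i)))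
      translations i = Translates-cong
        (λ j → cong₂ (λ a b → Λ-pair i (- a) (- b) j)
                     (sym (lookup-++ˡ (α ∘ C) (β ∘ C) i)) (sym (lookup-++ʳ (α ∘ C) (β ∘ C) i)))
        (translation (C i))
      solves : ∀ j → Λmul k j ≡ Cr j - Cs j
      solves j = Equivalence.to (x-u≈y⇔u≈x-y (Cr j) (Λmul k j) (Cs j))
        (trans (sym (composeAll-translates-Λmul k translations Cr j)) (reaches j))
      χ≤e : ∀ i → χ {p} {n} k i ≤ e i
      χ≤e i = subst (_≤ e i) (sym (χ-++ (α ∘ C) (β ∘ C) i)) (weight≤eta (C i))

    SolSet? : Decidable (SolSet p Γ Cr Cs)
    SolSet? m = ∃-fun? respects (λ k →
      all? (λ j → Λmul k j ≟F Cr j - Cs j) ×-dec sumℕ (χ {p} {n} k) ℕ.≟ m ×-dec 0 ℕ.<? m)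
      where
      respects : ∀ {k k′} → (∀ c → k c ≡ k′ c) →
                 (∀ j → Λmul k j ≡ Cr j - Cs j) × sumℕ (χ {p} {n} k) ≡ m × 0 < m →
                 (∀ j → Λmul k′ j ≡ Cr j - Cs j) × sumℕ (χ {p} {n} k′) ≡ m × 0 < m
      respects {k} {k′} k≗k′ (solves , χ≡m , 0<m) =
        (λ j → trans (sym (Λmul-cong k≗k′ j)) (solves j)) ,
        trans (sumℕ-cong λ i → cong₂ weight (sym (k≗k′ (i ↑ˡ n))) (sym (k≗k′ (n ↑ʳ i)))) χ≡m ,
        0<m

    difference-solution : SolSet p Γ Cr Cs (sumℕ (χ {p} {n} ((λ i → Cr i - Cs i) ++ λ _ → 0#)))
    difference-solution = k , solves , refl , Sol-positive solves
      where
      k = (λ i → Cr i - Cs i) ++ λ _ → 0#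
      solves : ∀ j → Λmul k j ≡ Cr j - Cs j
      solves j = begin
        Λmul k j                                          ≡⟨ Λmul-++ (λ i → Cr i - Cs i) (λ _ → 0#) j ⟩
        sum (λ i → (Cr i - Cs i) * δ i j + 0# * Γ i j)    ≡⟨ sum-cong-≗ drop-Γ-part ⟩
        sum (λ i → (Cr i - Cs i) * δ i j)                 ≡⟨ ∑-δ (λ i → Cr i - Cs i) j ⟩
        Cr j - Cs j                                       ∎
        where
        drop-Γ-part : ∀ i → (Cr i - Cs i) * δ i j + 0# * Γ i j ≡ (Cr i - Cs i) * δ i j
        drop-Γ-part i = trans (cong ((Cr i - Cs i) * δ i j +_) (zeroˡ (Γ i j))) (+-identityʳ _)

theorem3 : (p : ℕ) .{{_ : NonZero p}} → Prime p →
    (n : ℕ) (mult : Fin n → Fin n → ℕ) →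
    (∀ i j → mult i j ≡ mult j i) →
    (Cr Cs : Labelling p n) →
    ¬ (∀ j → Cr j ≡ Cs j) →
    Σ ℕ (λ Δ → DiagonalDistance p (adj p mult) Cr Cs Δ
    × IsMin (SolSet p (adj p mult) Cr Cs) Δ)
theorem3 p _ n mult mult-sym Cr Cs Cr≢Cs =
  let (Δ , minSol) = IsMin-of-decidable SolSet? difference-solution
  in Δ , IsMin-transport Diag⇒Sol Sol⇒Diag minSol , minSol
  where
  open Translations p (adj p mult)
  open Correspondence (λ i j → cong (_mod p) (mult-sym i j)) Cr Cs Cr≢Cs
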